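{- Let $X$, GreedyArb, $j,k,P,P_l,Q,Q_r$ and the notions hidden/exposed be as in the context. (a) If $p\in P$ is hidden at some time $s$ and exposed at time $s+1$, then the point of $X$ with $y$-coordinate $s$ belongs to $P$. (b) Let $p\in P$ be hidden at time $t$, and let $t'\ge t$ be such that $p$ is hidden at every time $s$ with $t\le s\le t'$ and exposed at time $t'+1$. If $q\in P_l\cup Q\cup Q_r$ satisfies $t<q.y<t'$, then GreedyArb does not add the point $(p.x,q.y)$.
   Context: Let $n\ge1$ and $X=\{p_1,\dots,p_n\}\subset\mathbb{Z}^2$ with $p_i=(i,t_i)$, where $(t_1,\dots,t_n)$ is a permutation of $\{1,\dots,n\}$; $a.x,a.y$ denote the coordinates of a point $a$. For points $a,b$ not on a common horizontal or vertical line, $\Box ab$ is the closed axis-parallel rectangle with opposite corners $a,b$. GreedyArb: for $t=1,\dots,n$ in order, let $p$ be the point of $X$ with $p.y=t$ and let $Z_t$ be the set of points of $X$ with $y$-coordinate $<t$ together with all points added at earlier steps; add $M_p=\{(q.x,t): q\in Z_t,\ q.x\ne p.x,\ \Box pq\text{ contains no point of }Z_t\cup\{p\}\text{ other than }p,q\}$. Let $Y=\bigcup_{p\in X}M_p$. Fix integers $j,k\ge1$ with $j+2k-1\le n$. Let $P_l=\{p_1,\dots,p_{j-1}\}$, $P=\{p_j,\dots,p_{j+k-1}\}$, $Q=\{p_{j+k},\dots,p_{j+2k-1}\}$, $Q_r=\{p_{j+2k},\dots,p_n\}$, and $R_P=\{(x,y): j-\tfrac12<x<j+k-\tfrac12\}$.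 For $p\in P$ and an integer $t>p.y$, let $T^p_{<t}$ be the set of points of $X\cup Y$ on the line $x=p.x$ with $y$-coordinate $<t$, and let $r$ be the point of $T^p_{<t}$ with largest $y$-coordinate. The point $p$ is hidden at time $t$ if there exist points of $X\cup Y$ in $R_P$ on the line $y=r.y$, one with $x$-coordinate $<r.x$ and one with $x$-coordinate $>r.x$; otherwise $p$ is exposed at time $t$. -}

module Defs where

open import Data.Nat using (ℕ; zero; suc; _+_; _*_; _≤_; _<_)
open import Data.Fin using (Fin; toℕ)
open import Data.Fin.Permutation using (Permutation′; _⟨$⟩ʳ_)
open import Data.Product using (Σ; _×_; ∃-syntax)
open import Data.Sum using (_⊎_)
open import Data.Empty using (⊥)
open import Relation.Binary.PropositionalEquality using (_≡_; _≢_)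
open import Relation.Nullary using (¬_)

-- The point set X = {p_1,...,p_n}, p_i = (i, t_i), given by a permutation
-- π of Fin n: for i : Fin n the point is (toℕ i + 1, toℕ (π i) + 1).

module _ (n : ℕ) (π : Permutation′ n) where

  px : Fin n → ℕ
  px i = suc (toℕ i)

  py : Fin n → ℕ
  py i = suc (toℕ (π ⟨$⟩ʳ i))

  InX : ℕ → ℕ → Set
  InX x y = Σ (Fin n) λ i → x ≡ px i × y ≡ py i

  InBox : ℕ → ℕ → ℕ → ℕ → ℕ → ℕ → Set
  InBox x1 y1 x2 y2 a b =
    ((x1 ≤ a × a ≤ x2) ⊎ (x2 ≤ a × a ≤ x1)) ×
    ((y1 ≤ b × b ≤ y2) ⊎ (y2 ≤ b × b ≤ y1))

  mutual
    -- Z t x y : (x , y) ∈ Z_t, i.e. (x , y) is a point of X with y < t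
    -- or a point added by GreedyArb at one of the steps 1 .. t-1.
    Z : ℕ → ℕ → ℕ → Set
    Z zero    x y = ⊥
    Z (suc t) x y = Z t x y ⊎ (y ≡ t × (InX x t ⊎ Added t x))

    -- Added t x : (x , t) ∈ M_p where p is the point of X with p.y = t,
    -- i.e. GreedyArb adds the point (x , t) at step t.
    Added : ℕ → ℕ → Set
    Added t x = Σ (Fin n) λ i → py i ≡ t × x ≢ px i ×
      (Σ ℕ λ qy → Z t x qy ×
        (∀ a b → (Z t a b ⊎ (a ≡ px i × b ≡ t)) →
           InBox (px i) t x qy a b →
           (a ≡ px i × b ≡ t) ⊎ (a ≡ x × b ≡ qy)))

  InY : ℕ → ℕ → Set
  InY x y = Added y x

  InXY : ℕ → ℕ → Set
  InXY x y = InX x y ⊎ InY x y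

  IsTop : ℕ → ℕ → ℕ → Set
  IsTop x0 t ry = InXY x0 ry × ry < t × (∀ y → InXY x0 y → y < t → y ≤ ry)

  -- p = p_i (i ∈ P) is hidden at time t, for the block P with parameters j, k:
  -- R_P is the strip j - 1/2 < x < j + k - 1/2, i.e. j ≤ x < j + k.
  Hidden : (j k : ℕ) → Fin n → ℕ → Set
  Hidden j k i t = Σ ℕ λ ry → IsTop (px i) t ry ×
    (Σ ℕ λ a → InXY a ry × j ≤ a × a < px i) ×
    (Σ ℕ λ b → InXY b ry × px i < b × b < j + k)

  Exposed : (j k : ℕ) → Fin n → ℕ → Set
  Exposed j k i t = ¬ Hidden j k i t

  InP : (j k : ℕ) → Fin n → Set
  InP j k i = j ≤ px i × px i < j + k

module Submission where

-- If p is hidden at time s, witnessed by points a < p.x < b of the strip R_P in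
-- the row r.y < s of the current top r of p's column, then no point outside P
-- can add a point on p's column at step s: the rectangle it would span reaches
-- down to a point of Z_s no higher than r, so it contains a or b.
-- (a) A column changes only when a point is added to it, so a change of the top
-- at time s comes from the point of X in row s, which therefore lies in P.
-- (b) At every time s in the hidden stretch, the point of X in row s is the
-- only one that can add on row s.

open import Defs
open import Data.Nat using (ℕ; suc; _+_; _*_; _≤_; _<_; _≤?_; _<?_; _≟_)
open import Data.Nat.Properties
  using (<⇒≤; <⇒≢; <-irrefl; <-≤-trans; m<n⇒m<1+n; m<1+n⇒m<n∨m≡n; n<1+n; suc-injective; ≰⇒>; ≮⇒≥)
open import Data.Fin using (Fin)
open import Data.Fin.Properties using (any?; toℕ-injective)
open import Data.Fin.Permutation using (Permutation′; _⟨$⟩ʳ_; _⟨$⟩ˡ_; inverseˡ)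
open import Data.Product using (Σ; _×_; _,_; proj₁)
open import Data.Sum using (_⊎_; inj₁; inj₂)
open import Data.Empty using (⊥; ⊥-elim)
open import Function using (_∘_)
open import Relation.Binary.PropositionalEquality using (_≡_; _≢_; refl; sym; cong; module ≡-Reasoning)
open import Relation.Nullary using (¬_; yes; no)
open import Relation.Nullary.Decidable using (_×-dec_)
open import Relation.Unary using (Decidable)

module _ (n : ℕ) (π : Permutation′ n) where

  px-injective : ∀ {i i′} → px n π i ≡ px n π i′ → i ≡ i′
  px-injective = toℕ-injective ∘ suc-injective

  py-injective : ∀ {i i′} → py n π i ≡ py n π i′ → i ≡ i′
  py-injective {i} {i′} eq = begin
    i                              ≡⟨ inverseˡ π ⟨
    π ⟨$⟩ˡ (π ⟨$⟩ʳ i)              ≡⟨ cong (π ⟨$⟩ˡ_) (toℕ-injective (suc-injective eq)) ⟩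
    π ⟨$⟩ˡ (π ⟨$⟩ʳ i′)             ≡⟨ inverseˡ π ⟩
    i′                             ∎
    where open ≡-Reasoning

  Z-sound : ∀ {s x y} → Z n π s x y → y < s × InXY n π x y
  Z-sound {suc s} (inj₁ z)            = let y<s , xy∈ = Z-sound z in m<n⇒m<1+n y<s , xy∈
  Z-sound {suc s} (inj₂ (refl , xy∈)) = n<1+n s , xy∈

  Z-complete : ∀ {s x y} → y < s → InXY n π x y → Z n π s x y
  Z-complete {suc s} y<1+s xy∈ with m<1+n⇒m<n∨m≡n y<1+s
  ... | inj₁ y<s  = inj₁ (Z-complete y<s xy∈)
  ... | inj₂ refl = inj₂ (refl , xy∈)

  Outside : ℕ → ℕ → Fin n → Set
  Outside j k i = px n π i < j ⊎ j + k ≤ px n π i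

  InP? : ∀ j k → Decidable (InP n π j k)
  InP? j k i = (j ≤? px n π i) ×-dec (px n π i <? j + k)

  ¬InP⇒Outside : ∀ {j k i} → ¬ InP n π j k i → Outside j k i
  ¬InP⇒Outside {j} {k} {i} i∉P with j ≤? px n π i
  ... | no  j≰i = inj₁ (≰⇒> j≰i)
  ... | yes j≤i = inj₂ (≮⇒≥ (λ i<j+k → i∉P (j≤i , i<j+k)))

  hidden⇒¬added-by-Outside : ∀ {j k p s} → Hidden n π j k p s →
    (ad : Added n π s (px n π p)) → ¬ Outside j k (proj₁ ad)
  hidden⇒¬added-by-Outside {p = p}
    (ry , (_ , ry<s , top) , (a , a∈ , j≤a , a<p) , (b , b∈ , p<b , b<j+k))
    (i , _ , _ , qy , qy∈Z , emptyBox) = λ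
      { (inj₁ i<j)   → blocked a a∈ (inj₁ (<⇒≤ (<-≤-trans i<j j≤a) , <⇒≤ a<p)) (<⇒≢ a<p)
      ; (inj₂ j+k≤i) → blocked b b∈ (inj₂ (<⇒≤ p<b , <⇒≤ (<-≤-trans b<j+k j+k≤i))) (<⇒≢ p<b ∘ sym)
      }
    where
    qy≤ry : qy ≤ ry
    qy≤ry = let qy<s , qy∈ = Z-sound qy∈Z in top qy qy∈ qy<s

    blocked : ∀ c → InXY n π c ry →
      (px n π i ≤ c × c ≤ px n π p) ⊎ (px n π p ≤ c × c ≤ px n π i) → c ≢ px n π p → ⊥
    blocked c c∈ between c≢p
      with emptyBox c ry (inj₁ (Z-complete ry<s c∈)) (between , inj₂ (qy≤ry , <⇒≤ ry<s))
    ... | inj₁ (_ , ry≡s) = <-irrefl ry≡s ry<s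
    ... | inj₂ (c≡p , _)  = c≢p c≡p

  hidden-suc : ∀ {j k p s} → Hidden n π j k p s → ¬ InXY n π (px n π p) s → Hidden n π j k p (suc s)
  hidden-suc {p = p} {s} (ry , (ry∈ , ry<s , top) , left , right) s∉column =
    ry , (ry∈ , m<n⇒m<1+n ry<s , top′) , left , right
    where
    top′ : ∀ y → InXY n π (px n π p) y → y < suc s → y ≤ ry
    top′ y y∈ y<1+s with m<1+n⇒m<n∨m≡n y<1+s
    ... | inj₁ y<s  = top y y∈ y<s
    ... | inj₂ refl = ⊥-elim (s∉column y∈)

  hidden-then-exposed⇒row-in-P : ∀ {j k p s} → py n π p < s →
    Hidden n π j k p s → Exposed n π j k p (suc s) →
    Σ (Fin n) λ r → py n π r ≡ s × InP n π j k r
  hidden-then-exposed⇒row-in-P {j} {k} {p} {s} py<s hidden exposed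
    with any? (λ r → (py n π r ≟ s) ×-dec InP? j k r)
  ... | yes row∈P = row∈P
  ... | no  row∉P = ⊥-elim (exposed (hidden-suc hidden s∉column))
    where
    s∉column : ¬ InXY n π (px n π p) s
    s∉column (inj₁ (i , p≡i , s≡i)) with px-injective {p} {i} p≡i
    ... | refl = <-irrefl (sym s≡i) py<s
    s∉column (inj₂ ad@(i , py≡s , _)) =
      hidden⇒¬added-by-Outside hidden ad (¬InP⇒Outside (λ i∈P → row∉P (i , py≡s , i∈P)))

  hidden⇒¬added-on-Outside-row : ∀ {j k p} (q : Fin n) → Hidden n π j k p (py n π q) →
    Outside j k q → ¬ Added n π (py n π q) (px n π p)
  hidden⇒¬added-on-Outside-row q hidden q-outside ad@(i , py≡ , _)
    with py-injective {i} {q} py≡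
  ... | refl = hidden⇒¬added-by-Outside hidden ad q-outside

corollary1 : (n : ℕ) (π : Permutation′ n) (j k : ℕ) → 1 ≤ j → 1 ≤ k → j + 2 * k ≤ suc n →
    ((p : Fin n) → InP n π j k p → (s : ℕ) → py n π p < s →
      Hidden n π j k p s → Exposed n π j k p (suc s) →
      Σ (Fin n) λ r → py n π r ≡ s × InP n π j k r)
    ×
    ((p : Fin n) → InP n π j k p → (t t′ : ℕ) → py n π p < t → t ≤ t′ →
      ((s : ℕ) → t ≤ s → s ≤ t′ → Hidden n π j k p s) →
      Exposed n π j k p (suc t′) →
      (q : Fin n) → (px n π q < j ⊎ j + k ≤ px n π q) →
      t < py n π q → py n π q < t′ →
      ¬ Added n π (py n π q) (px n π p))
corollary1 n π j k _ _ _ =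
    (λ _ _ _ py<s → hidden-then-exposed⇒row-in-P n π py<s)
  , λ _ _ _ _ _ _ hiddenThroughout _ q q-outside t<q q<t′ →
      hidden⇒¬added-on-Outside-row n π q (hiddenThroughout (py n π q) (<⇒≤ t<q) (<⇒≤ q<t′)) q-outside
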